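{- Let $G=P_3$ be the path with consecutive vertices $x,v_1,v_2$, with weight function $\omega:E(G)\to\{1,2,3,\dots\}$. Then for every positive integer $t$, $\pi_t(G_\omega,x)=t\,\omega(xv_1)\,\omega(v_1v_2)$.
   Context: A pebble distribution is a function $p:V(G)\to\mathbb{Z}_{\ge0}$, of size $\sum_w p(w)$. For an edge $yz$, the pebbling move $(y\to z)$ removes $\omega(yz)$ pebbles from $y$ and adds one pebble at $z$. A sequence of moves is executable from $p$ if after each move every vertex has a nonnegative number of pebbles. Vertex $x$ is $t$-reachable from $p$ if some sequence executable from $p$ results in at least $t$ pebbles on $x$. $\pi_t(G_\omega,x)$ is the minimum $m$ such that $x$ is $t$-reachable from every pebble distribution of size $m$. -}

module Defs where

open import Data.Nat using (ℕ; zero; suc; _+_; _*_; _∸_; _≤_; _<_; _≥_)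
open import Data.Fin using (Fin; zero; suc)
open import Data.List using (List; []; _∷_)
open import Data.Maybe using (Maybe; just; nothing)
open import Data.Product using (Σ; ∃; _×_; _,_)
open import Relation.Nullary using (¬_)
open import Relation.Binary.PropositionalEquality using (_≡_)
open import Data.Fin using (_≟_)
open import Relation.Nullary using (yes; no)

-- A weighted graph on vertex set Fin n: for each ordered pair (y , z),
-- either no edge (nothing) or an edge of weight w (just w).
-- (Symmetry / positivity are imposed by the concrete instance below.)
WeightedGraph : ℕ → Set
WeightedGraph n = Fin n → Fin n → Maybe ℕ

Distribution : ℕ → Set
Distribution n = Fin n → ℕ

size : ∀ {n} → Distribution n → ℕ
size {zero}  p = 0
size {suc n} p = p zero + size (λ i → p (suc i))

Move : ℕ → Set
Move n = Fin n × Fin n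

addAt : ∀ {n} → Fin n → ℕ → Distribution n → Distribution n
addAt z k p v with v ≟ z
... | yes _ = p v + k
... | no  _ = p v

-- remove k pebbles at vertex y (only used when p y ≥ k)
subAt : ∀ {n} → Fin n → ℕ → Distribution n → Distribution n
subAt y k p v with v ≟ y
... | yes _ = p v ∸ k
... | no  _ = p v

data Step {n} (G : WeightedGraph n) : Distribution n → Move n → Distribution n → Set where
  step : ∀ {p y z w} → G y z ≡ just w → w ≤ p y →
         Step G p (y , z) (addAt z 1 (subAt y w p))

data Executes {n} (G : WeightedGraph n) : Distribution n → List (Move n) → Distribution n → Set where
  done : ∀ {p} → Executes G p [] p
  _∷_  : ∀ {p q r m ms} → Step G p m q → Executes G q ms r → Executes G p (m ∷ ms) r

Reachable : ∀ {n} → WeightedGraph n → Fin n → ℕ → Distribution n → Set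
Reachable G x t p = Σ (List (Move _)) λ ms → Σ (Distribution _) λ q → Executes G p ms q × t ≤ q x

AllReach : ∀ {n} → WeightedGraph n → Fin n → ℕ → ℕ → Set
AllReach G x t m = (p : Distribution _) → size p ≡ m → Reachable G x t p

IsPebblingNumber : ∀ {n} → WeightedGraph n → Fin n → ℕ → ℕ → Set
IsPebblingNumber G x t m = AllReach G x t m × (∀ m' → m' < m → ¬ AllReach G x t m')

-- the path P₃ with vertices x = 0, v₁ = 1, v₂ = 2, ω(x v₁) = a, ω(v₁ v₂) = b
P3 : ℕ → ℕ → WeightedGraph 3
P3 a b zero (suc zero) = just a
P3 a b (suc zero) zero = just a
P3 a b (suc zero) (suc (suc zero)) = just b
P3 a b (suc (suc zero)) (suc zero) = just b
P3 a b _ _ = nothing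

-- Give a pebble on v₂ weight 1, on v₁ weight b and on x weight ab.  No pebbling
-- move increases the total weight, and t pebbles on x weigh tab, so a pile of
-- fewer than tab pebbles on v₂ cannot put t pebbles on x.  Conversely, from any
-- tab pebbles let s = t ∸ p(x) be the shortfall at x and j = sa ∸ p(v₁) the
-- shortfall at v₁: since p(v₂) = tab − p(x) − p(v₁) ≥ tab − p(x)ab − p(v₁)b = jb,
-- we can first move j pebbles from v₂ to v₁ and then s pebbles from v₁ to x.
module Submission where

open import Defs
open import Data.Nat using (ℕ; _*_; _≥_)
open import Data.Fin using (zero)

open import Data.Nat using (suc; _+_; _∸_; _≤_; _<_; NonZero; >-nonZero; >-nonZero⁻¹)
open import Data.Nat.Properties hiding (_≟_; suc-injective)
open import Data.Nat.Tactic.RingSolver using (solve-∀)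
open import Data.Fin using (Fin; suc; _≟_)
open import Data.Fin.Properties using (suc-injective)
open import Data.List using (List; []; _∷_; _++_)
open import Data.Maybe using (just)
open import Data.Product using (_,_)
open import Data.Empty using (⊥-elim)
open import Function using (_∘_)
open import Relation.Nullary using (¬_; yes; no)
open import Relation.Binary.PropositionalEquality

private
  variable
    n : ℕ
    G : WeightedGraph n
    p q r : Distribution n
    ms ns : List (Move n)

addAt-same : ∀ (z : Fin n) k p → addAt z k p z ≡ p z + k
addAt-same z k p with z ≟ z
... | yes _   = refl
... | no  z≢z = ⊥-elim (z≢z refl)

addAt-other : ∀ {v z : Fin n} k p → v ≢ z → addAt z k p v ≡ p v
addAt-other {v = v} {z} k p v≢z with v ≟ z
... | yes v≡z = ⊥-elim (v≢z v≡z)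
... | no  _   = refl

subAt-same : ∀ (y : Fin n) k p → subAt y k p y ≡ p y ∸ k
subAt-same y k p with y ≟ y
... | yes _   = refl
... | no  y≢y = ⊥-elim (y≢y refl)

subAt-other : ∀ {v y : Fin n} k p → v ≢ y → subAt y k p v ≡ p v
subAt-other {v = v} {y} k p v≢y with v ≟ y
... | yes v≡y = ⊥-elim (v≢y v≡y)
... | no  _   = refl

_++ₑ_ : Executes G p ms q → Executes G q ns r → Executes G p (ms ++ ns) r
done     ++ₑ f = f
(s ∷ e)  ++ₑ f = s ∷ (e ++ₑ f)

weight : (Fin n → ℕ) → Distribution n → ℕ
weight {0}     c p = 0
weight {suc n} c p = c zero * p zero + weight (c ∘ suc) (p ∘ suc)

weight-cong : ∀ (c : Fin n → ℕ) → (∀ v → p v ≡ q v) → weight c p ≡ weight c q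
weight-cong {0}     c p≗q = refl
weight-cong {suc n} c p≗q =
  cong₂ _+_ (cong (c zero *_) (p≗q zero)) (weight-cong (c ∘ suc) (p≗q ∘ suc))

term≤weight : ∀ (c : Fin n → ℕ) p v → c v * p v ≤ weight c p
term≤weight c p zero    = m≤m+n _ _
term≤weight c p (suc v) = m≤n⇒m≤o+n (c zero * p zero) (term≤weight (c ∘ suc) (p ∘ suc) v)

weight-update : ∀ (c : Fin n → ℕ) p q v → (∀ u → u ≢ v → q u ≡ p u) →
                weight c q + c v * p v ≡ weight c p + c v * q v
weight-update {suc n} c p q zero q≗p
  rewrite weight-cong {p = q ∘ suc} {q = p ∘ suc} (c ∘ suc) (λ i → q≗p (suc i) λ ())
  = swap-outer (c zero * q zero) (weight (c ∘ suc) (p ∘ suc)) (c zero * p zero)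
  where
  swap-outer : ∀ x m y → x + m + y ≡ y + m + x
  swap-outer = solve-∀
weight-update {suc n} c p q (suc v) q≗p = begin
  (c zero * q zero + weight c′ q′) + c (suc v) * p (suc v)
    ≡⟨ +-assoc (c zero * q zero) _ _ ⟩
  c zero * q zero + (weight c′ q′ + c (suc v) * p (suc v))
    ≡⟨ cong₂ _+_ (cong (c zero *_) (q≗p zero λ ()))
                 (weight-update c′ p′ q′ v (λ u u≢v → q≗p (suc u) (u≢v ∘ suc-injective))) ⟩
  c zero * p zero + (weight c′ p′ + c (suc v) * q (suc v))
    ≡⟨ +-assoc (c zero * p zero) _ _ ⟨
  (c zero * p zero + weight c′ p′) + c (suc v) * q (suc v) ∎
  where
  open ≡-Reasoning
  c′ = c ∘ suc
  p′ = p ∘ suc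
  q′ = q ∘ suc

weight-addAt : ∀ (c : Fin n → ℕ) z k p → weight c (addAt z k p) ≡ weight c p + c z * k
weight-addAt c z k p = +-cancelʳ-≡ (c z * p z) _ _ (begin
  weight c (addAt z k p) + c z * p z
    ≡⟨ weight-update c p (addAt z k p) z (λ u → addAt-other k p) ⟩
  weight c p + c z * addAt z k p z
    ≡⟨ cong (λ m → weight c p + c z * m) (addAt-same z k p) ⟩
  weight c p + c z * (p z + k)
    ≡⟨ distrib _ (c z) (p z) k ⟩
  weight c p + c z * k + c z * p z ∎)
  where
  open ≡-Reasoning
  distrib : ∀ m x y k → m + x * (y + k) ≡ m + x * k + x * y
  distrib = solve-∀

weight-subAt : ∀ (c : Fin n → ℕ) y k p → k ≤ p y → weight c (subAt y k p) + c y * k ≡ weight c p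
weight-subAt c y k p k≤py = +-cancelʳ-≡ (c y * (p y ∸ k)) _ _ (begin
  weight c (subAt y k p) + c y * k + c y * (p y ∸ k)
    ≡⟨ distrib _ (c y) k (p y ∸ k) ⟩
  weight c (subAt y k p) + c y * (k + (p y ∸ k))
    ≡⟨ cong (λ m → weight c (subAt y k p) + c y * m) (m+[n∸m]≡n k≤py) ⟩
  weight c (subAt y k p) + c y * p y
    ≡⟨ weight-update c p (subAt y k p) y (λ u → subAt-other k p) ⟩
  weight c p + c y * subAt y k p y
    ≡⟨ cong (λ m → weight c p + c y * m) (subAt-same y k p) ⟩
  weight c p + c y * (p y ∸ k) ∎)
  where
  open ≡-Reasoning
  distrib : ∀ m x k l → m + x * k + x * l ≡ m + x * (k + l)
  distrib = solve-∀

PebblingPotential : WeightedGraph n → (Fin n → ℕ) → Set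
PebblingPotential G c = ∀ {y z w} → G y z ≡ just w → c z ≤ w * c y

weight-step : ∀ {c} {m : Move n} → PebblingPotential G c → Step G p m q → weight c q ≤ weight c p
weight-step {c = c} potential (step {p} {y} {z} {w} edge w≤py) = begin
  weight c (addAt z 1 (subAt y w p))  ≡⟨ weight-addAt c z 1 _ ⟩
  weight c (subAt y w p) + c z * 1    ≤⟨ +-monoʳ-≤ _ cz≤cy*w ⟩
  weight c (subAt y w p) + c y * w    ≡⟨ weight-subAt c y w p w≤py ⟩
  weight c p                          ∎
  where
  open ≤-Reasoning
  cz≤cy*w : c z * 1 ≤ c y * w
  cz≤cy*w rewrite *-identityʳ (c z) | *-comm (c y) w = potential edge

weight-executes : ∀ {c} → PebblingPotential G c → Executes G p ms q → weight c q ≤ weight c p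
weight-executes potential done    = ≤-refl
weight-executes potential (s ∷ e) = ≤-trans (weight-executes potential e) (weight-step potential s)

unreachable-if-light : ∀ {c} x t → PebblingPotential G c → weight c p < t * c x → ¬ Reachable G x t p
unreachable-if-light {c = c} x t potential light (ms , q , e , t≤qx) = <⇒≱ light (begin
  t * c x     ≤⟨ *-monoˡ-≤ (c x) t≤qx ⟩
  q x * c x   ≡⟨ *-comm (q x) (c x) ⟩
  c x * q x   ≤⟨ term≤weight c q x ⟩
  weight c q  ≤⟨ weight-executes potential e ⟩
  weight c _  ∎)
  where open ≤-Reasoning

record Transfer (G : WeightedGraph n) (p : Distribution n) (y z : Fin n) (k : ℕ) : Set where
  field
    moves     : List (Move n)
    result    : Distribution n
    executes  : Executes G p moves result
    target    : result z ≡ p z + k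
    unchanged : ∀ v → v ≢ y → v ≢ z → result v ≡ p v

open Transfer

transfer : ∀ {y z w} → G y z ≡ just w → y ≢ z → ∀ k p → k * w ≤ p y → Transfer G p y z k
transfer edge y≢z 0 p _ = record
  { moves = [] ; result = p ; executes = done
  ; target = sym (+-identityʳ _) ; unchanged = λ _ _ _ → refl }
transfer {G = G} {y} {z} {w} edge y≢z (suc k) p kw≤py = record
  { moves     = (y , z) ∷ moves rest
  ; result    = result rest
  ; executes  = step edge w≤py ∷ executes rest
  ; target    = begin
      result rest z  ≡⟨ target rest ⟩
      p′ z + k       ≡⟨ cong (_+ k) (trans (addAt-same z 1 _) (cong (_+ 1) (subAt-other w p (y≢z ∘ sym)))) ⟩
      p z + 1 + k    ≡⟨ +-assoc (p z) 1 k ⟩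
      p z + suc k    ∎
  ; unchanged = λ v v≢y v≢z →
      trans (unchanged rest v v≢y v≢z) (trans (addAt-other 1 _ v≢z) (subAt-other w p v≢y))
  }
  where
  open ≡-Reasoning
  p′ = addAt z 1 (subAt y w p)
  w≤py : w ≤ p y
  w≤py = m+n≤o⇒m≤o w kw≤py
  rest : Transfer G p′ y z k
  rest = transfer edge y≢z k p′
    (subst (k * w ≤_) (sym (trans (addAt-other 1 _ y≢z) (subAt-same y w p)))
           (m+n≤o⇒m≤o∸n (k * w) (subst (_≤ p y) (+-comm w (k * w)) kw≤py)))

v₁ v₂ : Fin 3
v₁ = suc zero
v₂ = suc (suc zero)

module _ (a b : ℕ) .{{_ : NonZero a}} .{{_ : NonZero b}} where

  P3-weight : Fin 3 → ℕ
  P3-weight zero          = a * b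
  P3-weight (suc zero)    = b
  P3-weight (suc (suc _)) = 1

  P3-potential : PebblingPotential (P3 a b) P3-weight
  P3-potential {zero}             {suc zero}       refl = ≤-trans (m≤n*m b a) (m≤n*m (a * b) a)
  P3-potential {suc zero}         {zero}           refl = ≤-refl
  P3-potential {suc zero}         {suc (suc zero)} refl = >-nonZero⁻¹ (b * b) {{m*n≢0 b b}}
  P3-potential {suc (suc zero)}   {suc zero}       refl = ≤-reflexive (sym (*-identityʳ b))
  P3-potential {zero}             {zero}           ()
  P3-potential {zero}             {suc (suc zero)} ()
  P3-potential {suc zero}         {suc zero}       ()
  P3-potential {suc (suc zero)}   {zero}           ()
  P3-potential {suc (suc zero)}   {suc (suc zero)} ()

  pile-on-v₂ : ℕ → Distribution 3
  pile-on-v₂ m zero          = 0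
  pile-on-v₂ m (suc zero)    = 0
  pile-on-v₂ m (suc (suc _)) = m

  P3-lower : ∀ t m → m < t * a * b → ¬ AllReach (P3 a b) zero t m
  P3-lower t m m<tab allReach =
    unreachable-if-light zero t P3-potential light (allReach (pile-on-v₂ m) (+-identityʳ m))
    where
    light : weight P3-weight (pile-on-v₂ m) < t * (a * b)
    light rewrite *-zeroʳ (a * b) | *-zeroʳ b | +-identityʳ m | +-identityʳ m | sym (*-assoc t a b) = m<tab

  P3-upper : ∀ t → AllReach (P3 a b) zero t (t * a * b)
  P3-upper t p size≡tab =
    moves T₁ ++ moves T₂ , result T₂ , executes T₁ ++ₑ executes T₂ , t≤final
    where
    s = t ∸ p zero
    j = s * a ∸ p v₁

    total : p zero + p v₁ + p v₂ ≡ t * a * b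
    total = trans (trans (+-assoc (p zero) _ _) (cong (λ m → p zero + (p v₁ + m)) (sym (+-identityʳ _)))) size≡tab

    jb≤pv₂ : j * b ≤ p v₂
    jb≤pv₂ = begin
      (s * a ∸ p v₁) * b                         ≡⟨ *-distribʳ-∸ b (s * a) (p v₁) ⟩
      s * a * b ∸ p v₁ * b                       ≡⟨ cong (λ m → m * b ∸ p v₁ * b) (*-distribʳ-∸ a t (p zero)) ⟩
      (t * a ∸ p zero * a) * b ∸ p v₁ * b        ≡⟨ cong (_∸ p v₁ * b) (*-distribʳ-∸ b (t * a) (p zero * a)) ⟩
      t * a * b ∸ p zero * a * b ∸ p v₁ * b      ≡⟨ ∸-+-assoc (t * a * b) (p zero * a * b) (p v₁ * b) ⟩
      t * a * b ∸ (p zero * a * b + p v₁ * b)    ≤⟨ ∸-monoʳ-≤ (t * a * b) (+-mono-≤ (≤-trans (m≤m*n (p zero) a) (m≤m*n _ b)) (m≤m*n (p v₁) b)) ⟩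
      t * a * b ∸ (p zero + p v₁)                ≡⟨ cong (_∸ (p zero + p v₁)) (sym total) ⟩
      p zero + p v₁ + p v₂ ∸ (p zero + p v₁)     ≡⟨ m+n∸m≡n (p zero + p v₁) (p v₂) ⟩
      p v₂                                       ∎
      where open ≤-Reasoning

    T₁ : Transfer (P3 a b) p v₂ v₁ j
    T₁ = transfer refl (λ ()) j p jb≤pv₂

    T₂ : Transfer (P3 a b) (result T₁) v₁ zero s
    T₂ = transfer refl (λ ()) s (result T₁)
      (subst (s * a ≤_) (sym (target T₁)) (m≤n+m∸n (s * a) (p v₁)))

    t≤final : t ≤ result T₂ zero
    t≤final = subst (t ≤_)
      (sym (trans (target T₂) (cong (_+ s) (unchanged T₁ zero (λ ()) (λ ())))))
      (m≤n+m∸n t (p zero))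

proposition5p2 : (a b t : ℕ) → a ≥ 1 → b ≥ 1 → t ≥ 1 →
    IsPebblingNumber (P3 a b) zero t (t * a * b)
proposition5p2 a b t a≥1 b≥1 _ =
  P3-upper a b {{>-nonZero a≥1}} {{>-nonZero b≥1}} t ,
  P3-lower a b {{>-nonZero a≥1}} {{>-nonZero b≥1}} t
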